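{- Let $G$ be a graph (possibly with multiple edges) whose underlying simple graph is the wheel $W_5$. If $G'$ is an even subdivision or an odd expansion of $G$, then $G'$ has a claw, i.e. the underlying simple graph of $G'$ has an induced subgraph isomorphic to $K_{1,3}$.
   Context: Graphs are loopless, possibly with multiple edges; the underlying simple graph has one edge between each pair of adjacent vertices. $W_5$ is a 5-cycle together with a vertex adjacent to all its vertices. An even subdivision of $G$ at an edge $e=uv$ replaces $e$ by a $uv$-path of odd length at least three with new internal vertices. An odd expansion of $G$ at a vertex $v$: split $v$ into $v',v''$; add a $v'v''$-path of even length at least two with new internal vertices; distribute the edges of $G$ at $v$ among $v'$ and $v''$ so that each has at least one neighbour in $V(G-v)$; optionally add edges joining $v'$ and $v''$. -}

module Defs where

open import Data.Nat using (ℕ; zero; suc; _+_; _*_)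
open import Data.Fin using (Fin; zero; suc; _↑ˡ_; _↑ʳ_)
open import Data.List using (List; []; _∷_; _++_; map; length; lookup; removeAt; tabulate; replicate; allFin)
open import Data.List.Relation.Unary.All using (All)
open import Data.List.Relation.Unary.Any using (Any)
open import Data.Product using (_×_; _,_; proj₁; proj₂; Σ; ∃; ∃-syntax)
open import Data.Sum using (_⊎_)
open import Data.Bool using (Bool; true; false; if_then_else_)
open import Relation.Nullary using (¬_; does)
open import Relation.Binary.PropositionalEquality using (_≡_; _≢_)
open import Function.Bundles using (_⤖_; _⇔_; Bijection)
import Data.Fin as F

-- A (multi)graph: vertex set Fin n, edges a list (multiset) of unordered
-- pairs of vertices, each stored as an ordered pair (either orientation).
record Graph : Set where
  constructor mkGraph
  field
    n     : ℕ
    edges : List (Fin n × Fin n)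
open Graph public

Loopless : Graph → Set
Loopless G = All (λ e → proj₁ e ≢ proj₂ e) (edges G)

Adj : (G : Graph) → Fin (n G) → Fin (n G) → Set
Adj G x y = (x ≢ y) × Any (λ e → (e ≡ (x , y)) ⊎ (e ≡ (y , x))) (edges G)

W5 : Graph
W5 = mkGraph 6
  ( (w0 , w1) ∷ (w0 , w2) ∷ (w0 , w3) ∷ (w0 , w4) ∷ (w0 , w5)
  ∷ (w1 , w2) ∷ (w2 , w3) ∷ (w3 , w4) ∷ (w4 , w5) ∷ (w5 , w1) ∷ [])
  where
    w0 w1 w2 w3 w4 w5 : Fin 6
    w0 = F.#_ 0
    w1 = F.#_ 1
    w2 = F.#_ 2
    w3 = F.#_ 3
    w4 = F.#_ 4
    w5 = F.#_ 5

UnderlyingIsW5 : Graph → Set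
UnderlyingIsW5 G =
  Σ (Fin (n G) ⤖ Fin 6) λ f →
    ∀ x y → Adj G x y ⇔ Adj W5 (Bijection.to f x) (Bijection.to f y)

HasClaw : Graph → Set
HasClaw G = ∃[ c ] ∃[ a ] ∃[ b ] ∃[ d ]
  ( Adj G c a × Adj G c b × Adj G c d
  × a ≢ b × a ≢ d × b ≢ d
  × ¬ Adj G a b × ¬ Adj G a d × ¬ Adj G b d )

pathEdges : {A : Set} → A → List A → A → List (A × A)
pathEdges a []       b = (a , b) ∷ []
pathEdges a (x ∷ xs) b = (a , x) ∷ pathEdges x xs b

mapPair : {A B : Set} → (A → B) → A × A → B × B
mapPair f (x , y) = f x , f y

-- Even subdivision of G at the edge with index i: that edge uv is replaced
-- by a uv-path of length 2k+3 (odd, ≥ 3) whose 2k+2 internal vertices are new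
-- (the vertices n, n+1, ..., n+2k+1).
evenSubdivision : (G : Graph) → Fin (length (edges G)) → ℕ → Graph
evenSubdivision (mkGraph n es) i k =
  mkGraph (n + suc (suc (k + k)))
    ( map (mapPair old) (removeAt es i)
      ++ pathEdges (old (proj₁ (lookup es i)))
                   (map (n ↑ʳ_) (allFin (suc (suc (k + k)))))
                   (old (proj₂ (lookup es i))) )
  where
    old : Fin n → Fin (n + suc (suc (k + k)))
    old x = x ↑ˡ suc (suc (k + k))

IncidentAt : (G : Graph) → Fin (n G) → Fin (length (edges G)) → Set
IncidentAt G v j = (proj₁ (lookup (edges G) j) ≡ v) ⊎ (proj₂ (lookup (edges G) j) ≡ v)

-- A distribution d of the edges at v: edge j at v goes to v'' if d j = true,
-- to v' if d j = false (d is irrelevant on edges not at v).  Valid iff both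
-- v' and v'' receive at least one edge (in a loopless graph such an edge gives
-- a neighbour in V(G - v)).
ValidDistribution : (G : Graph) → Fin (n G) → (Fin (length (edges G)) → Bool) → Set
ValidDistribution G v d =
  (∃[ j ] IncidentAt G v j × d j ≡ false) × (∃[ j ] IncidentAt G v j × d j ≡ true)

-- Odd expansion of G at v: v is split into v' (= old vertex v) and v''
-- (= new vertex n); a v'v''-path of length 2k+2 (even, ≥ 2) with 2k+1 new
-- internal vertices (n+1, ..., n+2k+1) is added; edges at v are distributed by d;
-- m additional edges joining v' and v'' are added (m = 0 allowed).
oddExpansion : (G : Graph) → Fin (n G) → ℕ → ℕ → (Fin (length (edges G)) → Bool) → Graph
oddExpansion (mkGraph n es) v k m d =
  mkGraph (n + suc (suc (k + k)))
    ( tabulate (λ j → mapPair (ren j) (lookup es j))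
      ++ pathEdges v' (map (λ t → n ↑ʳ suc t) (allFin (suc (k + k)))) v''
      ++ replicate m (v' , v'') )
  where
    N = suc (suc (k + k))
    old : Fin n → Fin (n + N)
    old x = x ↑ˡ N
    v' : Fin (n + N)
    v' = old v
    v'' : Fin (n + N)
    v'' = n ↑ʳ zero
    ren : Fin (length es) → Fin n → Fin (n + N)
    ren j x = if does (x F.≟ v) then (if d j then v'' else v') else old x

-- In both cases the claw lives in a bounded piece of G'.  Such pieces are
-- described by finite boolean models (W5 with one edge or one neighbourhood
-- modified, plus a pendant vertex); a claw in a model transfers to any graph
-- realising the model as an induced subgraph (claw-transfer), and that every
-- relevant model has a claw is a finite fact checked by decision procedures
-- (setEdge-claw, replaceNbhd-claw).  The graph-specific work is to exhibit
-- realisations, in W5 coordinates given by the isomorphism: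
--  * subdividing uv: the old vertices, with uv present iff it was a multiple
--    edge, and the first new path vertex as a pendant at u;
--  * expanding v into v′, v″: the old vertices other than v together with one of
--    v′, v″ (carrying its share of the neighbours of v) and the path vertex next
--    to it as a pendant.  The two shares are nonempty and cover the
--    neighbourhood of v, which is what the finite check needs.
module Submission where

open import Defs
open import Data.Nat using (ℕ; zero; suc; _+_)
open import Data.Fin using (Fin; zero; suc; _↑ˡ_; _↑ʳ_; _≟_; splitAt)
open import Data.Fin.Properties using (any?; all?)
import Data.Fin.Properties as FinP
open import Data.Fin.Subset using (Subset)
open import Data.Vec using ([]; _∷_) renaming (lookup to _⟨_⟩)
import Data.Vec as Vec
import Data.Vec.Properties as VecP
open import Data.List using (List; []; _∷_; _++_; map; length; lookup; removeAt; tabulate; replicate)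
open import Data.List.Relation.Unary.All using (All; []; _∷_)
import Data.List.Relation.Unary.All as All
import Data.List.Relation.Unary.All.Properties as AllP
import Data.List.Relation.Unary.Any.Properties as AnyP
open import Data.List.Membership.Propositional using (lose)
open import Data.List.Membership.Propositional.Properties using (∈-lookup)
open import Data.List.Relation.Unary.Any using (Any; here; there)
import Data.List.Relation.Unary.Any as Any
open import Data.Bool using (Bool; true; false; T; not; _∧_; _∨_; if_then_else_)
import Data.Bool as Bool
import Data.Bool.Properties as BoolP
open import Data.Empty using (⊥-elim)
open import Data.Unit using (tt)
open import Data.Product using (_×_; _,_; proj₁; proj₂; ∃-syntax)
import Data.Product.Properties as Product
open import Data.Sum using (_⊎_; inj₁; inj₂)
import Data.Sum as Sum
open import Data.Sum.Function.Propositional using (_⊎-⇔_)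
open import Function using (_∘_)
open import Function.Bundles using (_⇔_; mk⇔; Equivalence; Bijection; Surjection)
import Function.Properties.Equivalence as Eq
open import Relation.Nullary using (¬_; Dec; yes; no; does)
open import Relation.Nullary.Decidable
  using (_×-dec_; _⊎-dec_; ¬?; _→-dec_; map′; toWitness; T?)
open import Relation.Binary.PropositionalEquality using (_≡_; _≢_; refl; sym; trans; cong; cong₂; subst; subst₂)

Joins : {A : Set} → A → A → A × A → Set
Joins x y e = (e ≡ (x , y)) ⊎ (e ≡ (y , x))

joins? : ∀ {m} (x y : Fin m) (e : Fin m × Fin m) → Dec (Joins x y e)
joins? x y e = Product.≡-dec _≟_ _≟_ e (x , y) ⊎-dec Product.≡-dec _≟_ _≟_ e (y , x)

Joins-swap : {A : Set} {x y : A} {e : A × A} → Joins x y e → Joins y x e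
Joins-swap (inj₁ p) = inj₂ p
Joins-swap (inj₂ p) = inj₁ p

Adj? : (G : Graph) → ∀ x y → Dec (Adj G x y)
Adj? G x y = ¬? (x ≟ y) ×-dec Any.any? (joins? x y) (edges G)

Adj-sym : (G : Graph) → ∀ {x y} → Adj G x y → Adj G y x
Adj-sym G (x≢y , e) = (x≢y ∘ sym) , Any.map Joins-swap e

Adj-sym⇔ : (G : Graph) → ∀ {x y} → Adj G x y ⇔ Adj G y x
Adj-sym⇔ G = mk⇔ (Adj-sym G) (Adj-sym G)

Joins-endpoint : {A : Set} {x y : A} {e : A × A} → Joins x y e → (proj₁ e ≡ x) ⊎ (proj₂ e ≡ x)
Joins-endpoint (inj₁ refl) = inj₁ refl
Joins-endpoint (inj₂ refl) = inj₂ refl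

Joins-push : {A B : Set} {h : A → B} {x y : A} {x′ y′ : B} {e : A × A} →
  h x ≡ x′ → h y ≡ y′ → Joins x y e → Joins x′ y′ (mapPair h e)
Joins-push refl refl (inj₁ refl) = inj₁ refl
Joins-push refl refl (inj₂ refl) = inj₂ refl

Joins-pull : {A B : Set} {h : A → B} {x y : B} {x′ y′ : A} →
  (∀ {s} → h s ≡ x → s ≡ x′) → (∀ {s} → h s ≡ y → s ≡ y′) →
  {e : A × A} → Joins x y (mapPair h e) → Joins x′ y′ e
Joins-pull pull-x pull-y (inj₁ q) = inj₁ (cong₂ _,_ (pull-x (cong proj₁ q)) (pull-y (cong proj₂ q)))
Joins-pull pull-x pull-y (inj₂ q) = inj₂ (cong₂ _,_ (pull-y (cong proj₁ q)) (pull-x (cong proj₂ q)))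

All-Joins : {A : Set} {Q : A → Set} {x y : A} {es : List (A × A)} →
  All (λ e → Q (proj₁ e) × Q (proj₂ e)) es → Any (Joins x y) es → Q x × Q y
All-Joins (qe ∷ _)         (here (inj₁ refl)) = qe
All-Joins ((q₁ , q₂) ∷ _)  (here (inj₂ refl)) = q₂ , q₁
All-Joins (_ ∷ qs)         (there j)          = All-Joins qs j

incident-other : (G : Graph) → Loopless G → ∀ {v} j → IncidentAt G v j →
  ∃[ x ] x ≢ v × Joins v x (lookup (edges G) j)
incident-other G loopless j (inj₁ e) =
  _ , (λ x≡v → All.lookup loopless (∈-lookup j) (trans e (sym x≡v))) , inj₁ (cong₂ _,_ e refl)
incident-other G loopless j (inj₂ e) =
  _ , (λ x≡v → All.lookup loopless (∈-lookup j) (trans x≡v (sym e))) , inj₂ (cong₂ _,_ refl e)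

removeAt⁻ : {A : Set} {P : A → Set} (xs : List A) (i : Fin (length xs)) →
  Any P (removeAt xs i) → Any P xs
removeAt⁻ (x ∷ xs) zero    p         = there p
removeAt⁻ (x ∷ xs) (suc i) (here p)  = here p
removeAt⁻ (x ∷ xs) (suc i) (there p) = there (removeAt⁻ xs i p)

removeAt⁺ : {A : Set} {P : A → Set} (xs : List A) (i : Fin (length xs)) →
  Any P xs → ¬ P (lookup xs i) → Any P (removeAt xs i)
removeAt⁺ (x ∷ xs) zero    (here p)  ¬p = ⊥-elim (¬p p)
removeAt⁺ (x ∷ xs) zero    (there p) ¬p = p
removeAt⁺ (x ∷ xs) (suc i) (here p)  ¬p = here p
removeAt⁺ (x ∷ xs) (suc i) (there p) ¬p = there (removeAt⁺ xs i p ¬p)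

path-sources : {A : Set} {Q : A → Set} (a : A) (zs : List A) (b : A) →
  Q a → All Q zs → All (Q ∘ proj₁) (pathEdges a zs b)
path-sources a []       b qa []         = qa ∷ []
path-sources a (z ∷ zs) b qa (qz ∷ qzs) = qa ∷ path-sources z zs b qz qzs

path-endpoints : {A : Set} {Q : A → Set} (a : A) (zs : List A) (b : A) →
  Q a → All Q zs → Q b → All (λ e → Q (proj₁ e) × Q (proj₂ e)) (pathEdges a zs b)
path-endpoints a []       b qa []         qb = (qa , qb) ∷ []
path-endpoints a (z ∷ zs) b qa (qz ∷ qzs) qb = (qa , qz) ∷ path-endpoints z zs b qz qzs qb

lastOf : {A : Set} → A → List A → A
lastOf a []       = a
lastOf a (z ∷ zs) = lastOf z zs

lastOf-All : {A : Set} {Q : A → Set} {a : A} {zs : List A} → Q a → All Q zs → Q (lastOf a zs)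
lastOf-All qa []         = qa
lastOf-All qa (qz ∷ qzs) = lastOf-All qz qzs

path-last-edge : {A : Set} (a : A) (zs : List A) (b : A) → Any (_≡ (lastOf a zs , b)) (pathEdges a zs b)
path-last-edge a []       b = here refl
path-last-edge a (z ∷ zs) b = there (path-last-edge z zs b)

does⇔ : {P : Set} (d : Dec P) → T (does d) ⇔ P
does⇔ (yes p) = mk⇔ (λ _ → p) (λ _ → tt)
does⇔ (no ¬p) = mk⇔ (λ ()) ¬p

T-injective : ∀ {x y} → T x ⇔ T y → x ≡ y
T-injective {false} {false} _ = refl
T-injective {false} {true}  e = ⊥-elim (Equivalence.from e tt)
T-injective {true}  {false} e = ⊥-elim (Equivalence.to e tt)
T-injective {true}  {true}  _ = refl

∀-Bool? : {P : Bool → Set} → (∀ b → Dec (P b)) → Dec (∀ b → P b)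
∀-Bool? P? = map′ (λ { (t , _) true → t ; (_ , f) false → f }) (λ h → h true , h false)
  (P? true ×-dec P? false)

∀-Subset? : ∀ {k} {P : Subset k → Set} → (∀ S → Dec (P S)) → Dec (∀ S → P S)
∀-Subset? {zero}  P? = map′ (λ { h [] → h }) (λ h → h []) (P? [])
∀-Subset? {suc k} P? =
  map′ (λ { (h , _) (true ∷ S) → h S ; (_ , h) (false ∷ S) → h S })
       (λ h → (λ S → h (true ∷ S)) , (λ S → h (false ∷ S)))
       (∀-Subset? (P? ∘ (true ∷_)) ×-dec ∀-Subset? (P? ∘ (false ∷_)))

Model : ℕ → Set
Model m = Fin m → Fin m → Bool

-- A claw in a model, listed in the order a search finds it: a centre c,
-- a leaf x, a second leaf y independent of x, a third leaf z independent of both.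
ClawIn : ∀ {m} → Model m → Set
ClawIn M =
  ∃[ c ] ∃[ x ] (T (M c x) ×
  ∃[ y ] ((T (M c y) × x ≢ y × ¬ T (M x y)) ×
  ∃[ z ] (T (M c z) × x ≢ z × y ≢ z × ¬ T (M x z) × ¬ T (M y z))))

clawIn? : ∀ {m} (M : Model m) → Dec (ClawIn M)
clawIn? M =
  any? λ c → any? λ x → T? (M c x) ×-dec
  any? λ y → (T? (M c y) ×-dec ¬? (x ≟ y) ×-dec ¬? (T? (M x y))) ×-dec
  any? λ z → T? (M c z) ×-dec ¬? (x ≟ z) ×-dec ¬? (y ≟ z) ×-dec ¬? (T? (M x z)) ×-dec ¬? (T? (M y z))

record Realises {m} (M : Model m) (G : Graph) : Set where
  field
    embed           : Fin m → Fin (n G)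
    embed-injective : ∀ {x y} → embed x ≡ embed y → x ≡ y
    adj⇔            : ∀ x y → Adj G (embed x) (embed y) ⇔ T (M x y)

claw-transfer : ∀ {m} {M : Model m} {G : Graph} → Realises M G → ClawIn M → HasClaw G
claw-transfer {M = M} {G = G} R (c , x , cx , y , (cy , x≢y , x≁y) , z , cz , x≢z , y≢z , x≁z , y≁z) =
  embed c , embed x , embed y , embed z ,
  adj cx , adj cy , adj cz ,
  x≢y ∘ embed-injective , x≢z ∘ embed-injective , y≢z ∘ embed-injective ,
  x≁y ∘ model , x≁z ∘ model , y≁z ∘ model
  where
  open Realises R
  adj : ∀ {u w} → T (M u w) → Adj G (embed u) (embed w)
  adj {u} {w} = Equivalence.from (adj⇔ u w)
  model : ∀ {u w} → Adj G (embed u) (embed w) → T (M u w)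
  model {u} {w} = Equivalence.to (adj⇔ u w)

withPendant : ∀ {m} → Fin m → Model m → Model (suc m)
withPendant a M zero    zero    = false
withPendant a M zero    (suc y) = does (y ≟ a)
withPendant a M (suc x) zero    = does (x ≟ a)
withPendant a M (suc x) (suc y) = M x y

pendant-realises : ∀ {m} {a : Fin m} {M : Model m} {G : Graph}
  (ι : Fin m → Fin (n G)) (p : Fin (n G)) →
  (∀ {x y} → ι x ≡ ι y → x ≡ y) → (∀ w → p ≢ ι w) →
  (∀ x y → Adj G (ι x) (ι y) ⇔ T (M x y)) → (∀ w → Adj G p (ι w) ⇔ (w ≡ a)) →
  Realises (withPendant a M) G
pendant-realises {m} {a} {M} {G} ι p ι-inj p-fresh ι-adj p-adj = record
  { embed = embed ; embed-injective = injective ; adj⇔ = adj⇔ }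
  where
  embed : Fin (suc m) → Fin (n G)
  embed zero    = p
  embed (suc w) = ι w

  injective : ∀ {x y} → embed x ≡ embed y → x ≡ y
  injective {zero}  {zero}  _ = refl
  injective {zero}  {suc y} e = ⊥-elim (p-fresh y e)
  injective {suc x} {zero}  e = ⊥-elim (p-fresh x (sym e))
  injective {suc x} {suc y} e = cong suc (ι-inj e)

  pendant⇔ : ∀ w → Adj G p (ι w) ⇔ T (does (w ≟ a))
  pendant⇔ w = Eq.trans (p-adj w) (Eq.sym (does⇔ (w ≟ a)))

  adj⇔ : ∀ x y → Adj G (embed x) (embed y) ⇔ T (withPendant a M x y)
  adj⇔ zero    zero    = mk⇔ (λ p~p → proj₁ p~p refl) (λ ())
  adj⇔ zero    (suc y) = pendant⇔ y
  adj⇔ (suc x) zero    = Eq.trans (Adj-sym⇔ G) (pendant⇔ x)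
  adj⇔ (suc x) (suc y) = ι-adj x y

w5 : Model 6
w5 zero    zero    = false
w5 zero    (suc _) = true
w5 (suc _) zero    = true
w5 (suc x) (suc y) = rim x y
  where
  rim : Fin 5 → Fin 5 → Bool
  rim zero                         (suc zero)                      = true
  rim zero                         (suc (suc (suc (suc zero))))    = true
  rim (suc zero)                   zero                            = true
  rim (suc zero)                   (suc (suc zero))                = true
  rim (suc (suc zero))             (suc zero)                      = true
  rim (suc (suc zero))             (suc (suc (suc zero)))          = true
  rim (suc (suc (suc zero)))       (suc (suc zero))                = true
  rim (suc (suc (suc zero)))       (suc (suc (suc (suc zero))))    = true
  rim (suc (suc (suc (suc zero)))) (suc (suc (suc zero)))          = true
  rim (suc (suc (suc (suc zero)))) zero                            = true
  rim _                            _                               = false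

w5-correct : ∀ x y → Adj W5 x y ⇔ T (w5 x y)
w5-correct = toWitness {a? = all? λ x → all? λ y → Adj? W5 x y ⇔? T? (w5 x y)} _
  where
  _⇔?_ : {P Q : Set} → Dec P → Dec Q → Dec (P ⇔ Q)
  P? ⇔? Q? = map′ (λ (f , g) → mk⇔ f g) (λ e → Equivalence.to e , Equivalence.from e)
    ((P? →-dec Q?) ×-dec (Q? →-dec P?))

setEdge : Fin 6 → Fin 6 → Bool → Model 6
setEdge a b s x y = if does (joins? x y (a , b)) then s else w5 x y

replaceNbhd : Fin 6 → Subset 6 → Model 6
replaceNbhd a S x y =
  if does (x ≟ a) then S ⟨ y ⟩ else if does (y ≟ a) then S ⟨ x ⟩ else w5 x y

Splits : Fin 6 → Subset 6 → Subset 6 → Set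
Splits a α β =
  (∀ w → (α ⟨ w ⟩ ∨ β ⟨ w ⟩) ≡ w5 a w) × (∃[ w ] T (α ⟨ w ⟩)) × (∃[ w ] T (β ⟨ w ⟩))

setEdge-claw : ∀ a b → T (w5 a b) → ∀ s → ClawIn (withPendant a (setEdge a b s))
setEdge-claw = toWitness {a? = all? λ a → all? λ b → T? (w5 a b) →-dec
  ∀-Bool? λ s → clawIn? (withPendant a (setEdge a b s))} _

replaceNbhd-claw : ∀ a α β → Splits a α β →
  ClawIn (withPendant a (replaceNbhd a α)) ⊎ ClawIn (withPendant a (replaceNbhd a β))
replaceNbhd-claw = toWitness {a? = all? λ a → ∀-Subset? λ α → ∀-Subset? λ β →
  splits? a α β →-dec
  (clawIn? (withPendant a (replaceNbhd a α)) ⊎-dec clawIn? (withPendant a (replaceNbhd a β)))} _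
  where
  splits? : ∀ a α β → Dec (Splits a α β)
  splits? a α β = all? (λ w → (α ⟨ w ⟩ ∨ β ⟨ w ⟩) Bool.≟ w5 a w)
    ×-dec any? (λ w → T? (α ⟨ w ⟩)) ×-dec any? (λ w → T? (β ⟨ w ⟩))

module W5Frame (G : Graph) (iso : UnderlyingIsW5 G) where
  φ : Fin (n G) → Fin 6
  φ = Bijection.to (proj₁ iso)

  g : Fin 6 → Fin (n G)
  g = Bijection.to⁻ (proj₁ iso)

  φ∘g : ∀ w → φ (g w) ≡ w
  φ∘g = Surjection.to∘to⁻ (Bijection.surjection (proj₁ iso))

  g∘φ : ∀ x → g (φ x) ≡ x
  g∘φ x = Bijection.injective (proj₁ iso) (φ∘g (φ x))

  g-injective : ∀ {x y} → g x ≡ g y → x ≡ y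
  g-injective {x} {y} e = trans (sym (φ∘g x)) (trans (cong φ e) (φ∘g y))

  g≡⇔ : ∀ {w x} → (g w ≡ x) ⇔ (w ≡ φ x)
  g≡⇔ {w} {x} = mk⇔ (λ e → trans (sym (φ∘g w)) (cong φ e)) (λ e → trans (cong g e) (g∘φ x))

  adj-frame : ∀ x y → Adj G (g x) (g y) ⇔ T (w5 x y)
  adj-frame x y = Eq.trans
    (subst₂ (λ s t → Adj G (g x) (g y) ⇔ Adj W5 s t) (φ∘g x) (φ∘g y) (proj₂ iso (g x) (g y)))
    (w5-correct x y)

module Blocks (N K : ℕ) where
  Vertex : Set
  Vertex = Fin (N + K)

  old : Fin N → Vertex
  old x = x ↑ˡ K

  new : Fin K → Vertex
  new t = N ↑ʳ t

  old-injective : ∀ {x y} → old x ≡ old y → x ≡ y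
  old-injective = FinP.↑ˡ-injective K _ _

  new-injective : ∀ {s t} → new s ≡ new t → s ≡ t
  new-injective = FinP.↑ʳ-injective N _ _

  old≢new : ∀ {x t} → old x ≢ new t
  old≢new {x} {t} e with trans (sym (FinP.splitAt-↑ˡ N x K))
                            (trans (cong (splitAt N) e) (FinP.splitAt-↑ʳ N K t))
  ... | ()

  IsNew : Vertex → Set
  IsNew z = ∃[ t ] z ≡ new t

  old-notNew : ∀ {x} → ¬ IsNew (old x)
  old-notNew (_ , e) = old≢new e

  ¬Joins-old-old : ∀ {x y e} → IsNew (proj₁ e) ⊎ IsNew (proj₂ e) → ¬ Joins (old x) (old y) e
  ¬Joins-old-old (inj₁ new₁) (inj₁ refl) = old-notNew new₁
  ¬Joins-old-old (inj₁ new₁) (inj₂ refl) = old-notNew new₁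
  ¬Joins-old-old (inj₂ new₂) (inj₁ refl) = old-notNew new₂
  ¬Joins-old-old (inj₂ new₂) (inj₂ refl) = old-notNew new₂

module EvenSubdivision (G : Graph) (loopless : Loopless G) (iso : UnderlyingIsW5 G)
                       (i : Fin (length (edges G))) (k : ℕ) where
  open W5Frame G iso
  open Blocks (n G) (suc (suc (k + k)))

  G' : Graph
  G' = evenSubdivision G i k

  u v : Fin (n G)
  u = proj₁ (lookup (edges G) i)
  v = proj₂ (lookup (edges G) i)

  R : List (Fin (n G) × Fin (n G))
  R = removeAt (edges G) i

  p p₁ : Vertex
  p  = new zero
  p₁ = new (suc zero)

  tail : List (Vertex × Vertex)
  tail = pathEdges p₁ (map new (tabulate (λ t → suc (suc t)))) (old v)

  tail-new-sources : All (IsNew ∘ proj₁) tail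
  tail-new-sources = path-sources p₁ _ (old v) (_ , refl) (AllP.map⁺ (AllP.tabulate⁺ (λ t → _ , refl)))

  tail-avoids-p : All (λ e → (proj₁ e ≢ p) × (proj₂ e ≢ p)) tail
  tail-avoids-p = path-endpoints p₁ _ (old v) ((λ ()) ∘ new-injective)
    (AllP.map⁺ (AllP.tabulate⁺ (λ t → (λ ()) ∘ new-injective))) old≢new

  -- edges G' = map (mapPair old) R ++ (old u , p) ∷ (p , p₁) ∷ tail, definitionally
  old-adj⇔ : ∀ {x y} → Adj G' (old x) (old y) ⇔ (x ≢ y × Any (Joins x y) R)
  old-adj⇔ {x} {y} = mk⇔ to from
    where
    kept : Any (Joins (old x) (old y)) (edges G') → Any (Joins x y) R
    kept j with AnyP.++⁻ (map (mapPair old) R) j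
    ... | inj₁ r                 = Any.map (Joins-pull old-injective old-injective) (AnyP.map⁻ r)
    ... | inj₂ (here j₁)         = ⊥-elim (¬Joins-old-old (inj₂ (_ , refl)) j₁)
    ... | inj₂ (there (here j₂)) = ⊥-elim (¬Joins-old-old (inj₁ (_ , refl)) j₂)
    ... | inj₂ (there (there t)) with All.lookupAny tail-new-sources t
    ...   | new₁ , jₜ = ⊥-elim (¬Joins-old-old (inj₁ new₁) jₜ)
    to : Adj G' (old x) (old y) → x ≢ y × Any (Joins x y) R
    to (ne , j) = ne ∘ cong old , kept j
    from : x ≢ y × Any (Joins x y) R → Adj G' (old x) (old y)
    from (ne , j) = ne ∘ old-injective , AnyP.++⁺ˡ (AnyP.map⁺ (Any.map (Joins-push refl refl) j))

  p-adj⇔ : ∀ {x} → Adj G' p (old x) ⇔ (x ≡ u)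
  p-adj⇔ {x} = mk⇔ to from
    where
    to : Adj G' p (old x) → x ≡ u
    to (_ , j) with AnyP.++⁻ (map (mapPair old) R) j
    ... | inj₁ r with Any.satisfied (AnyP.map⁻ r)
    ...   | _ , j′ with Joins-endpoint j′
    ...     | inj₁ e = ⊥-elim (old≢new e)
    ...     | inj₂ e = ⊥-elim (old≢new e)
    to (_ , j) | inj₂ (here (inj₁ e))         = ⊥-elim (old≢new (cong proj₁ e))
    to (_ , j) | inj₂ (here (inj₂ e))         = sym (old-injective (cong proj₁ e))
    to (_ , j) | inj₂ (there (here (inj₁ e))) = ⊥-elim (old≢new (sym (cong proj₂ e)))
    to (_ , j) | inj₂ (there (here (inj₂ e))) = ⊥-elim (old≢new (sym (cong proj₁ e)))
    to (_ , j) | inj₂ (there (there t)) with All.lookupAny tail-avoids-p t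
    ... | (≢p₁ , ≢p₂) , jₜ with Joins-endpoint jₜ
    ...   | inj₁ e = ⊥-elim (≢p₁ e)
    ...   | inj₂ e = ⊥-elim (≢p₂ e)
    from : x ≡ u → Adj G' p (old x)
    from refl = old≢new ∘ sym , AnyP.++⁺ʳ (map (mapPair old) R) (here (inj₂ refl))

  a b : Fin 6
  a = φ u
  b = φ v

  s : Bool
  s = does (Any.any? (joins? u v) R)

  ι : Fin 6 → Vertex
  ι w = old (g w)

  uv-adj : Adj G u v
  uv-adj = All.lookup loopless (∈-lookup i) , lose (∈-lookup i) (inj₁ refl)

  ab-adj : T (w5 a b)
  ab-adj = Equivalence.to (adj-frame a b) (subst₂ (Adj G) (sym (g∘φ u)) (sym (g∘φ v)) uv-adj)

  ab-adj⇔ : Adj G' (ι a) (ι b) ⇔ T s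
  ab-adj⇔ = subst₂ (λ x y → Adj G' (old x) (old y) ⇔ T s) (sym (g∘φ u)) (sym (g∘φ v))
    (Eq.trans old-adj⇔ (Eq.trans (mk⇔ proj₂ (proj₁ uv-adj ,_)) (Eq.sym (does⇔ (Any.any? (joins? u v) R)))))

  other-adj⇔ : ∀ {x y} → ¬ Joins x y (a , b) → Adj G' (ι x) (ι y) ⇔ T (w5 x y)
  other-adj⇔ {x} {y} ¬ab = Eq.trans old-adj⇔ (Eq.trans
    (mk⇔ (λ (ne , j) → ne , removeAt⁻ (edges G) i j) (λ (ne , j) → ne , removeAt⁺ (edges G) i j (¬ab ∘ in-frame)))
    (adj-frame x y))
    where
    in-frame : Joins (g x) (g y) (lookup (edges G) i) → Joins x y (a , b)
    in-frame j = subst₂ (λ x′ y′ → Joins x′ y′ (a , b)) (φ∘g x) (φ∘g y) (Joins-push {h = φ} refl refl j)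

  joined-adj⇔ : ∀ {x y} → Joins x y (a , b) → Adj G' (ι x) (ι y) ⇔ T s
  joined-adj⇔ (inj₁ refl) = ab-adj⇔
  joined-adj⇔ (inj₂ refl) = Eq.trans (Adj-sym⇔ G') ab-adj⇔

  ι-adj⇔ : ∀ x y → Adj G' (ι x) (ι y) ⇔ T (setEdge a b s x y)
  ι-adj⇔ x y = by-cases (joins? x y (a , b))
    where
    by-cases : (d : Dec (Joins x y (a , b))) →
      Adj G' (ι x) (ι y) ⇔ T (if does d then s else w5 x y)
    by-cases (yes ab) = joined-adj⇔ ab
    by-cases (no ¬ab) = other-adj⇔ ¬ab

  claw : HasClaw G'
  claw = claw-transfer
    (pendant-realises ι p (g-injective ∘ old-injective) (λ w → old≢new ∘ sym) ι-adj⇔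
      (λ w → Eq.trans p-adj⇔ g≡⇔))
    (setEdge-claw a b ab-adj s)

module OddExpansion (G : Graph) (loopless : Loopless G) (iso : UnderlyingIsW5 G)
                    (v : Fin (n G)) (k m : ℕ) (d : Fin (length (edges G)) → Bool) where
  open W5Frame G iso
  open Blocks (n G) (suc (suc (k + k)))

  G' : Graph
  G' = oddExpansion G v k m d

  v′ v″ : Vertex
  v′ = old v
  v″ = new zero

  side : Bool → Vertex
  side b = if b then v″ else v′

  ren : Fin (length (edges G)) → Fin (n G) → Vertex
  ren j x = if does (x ≟ v) then side (d j) else old x

  p : Vertex
  p = new (suc zero)

  rest : List Vertex
  rest = map (λ t → new (suc t)) (tabulate suc)

  q : Vertex
  q = lastOf p rest

  IsInner : Vertex → Set
  IsInner z = ∃[ t ] z ≡ new (suc t)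

  Local : Vertex → Set
  Local z = (z ≡ v′) ⊎ (z ≡ v″) ⊎ IsInner z

  rest-inner : All IsInner rest
  rest-inner = AllP.map⁺ (AllP.tabulate⁺ (λ t → _ , refl))

  -- edges G' = old-images ++ added, definitionally
  old-images : List (Vertex × Vertex)
  old-images = tabulate (λ j → mapPair (ren j) (lookup (edges G) j))

  added : List (Vertex × Vertex)
  added = pathEdges v′ (p ∷ rest) v″ ++ replicate m (v′ , v″)

  added-local : All (λ e → Local (proj₁ e) × Local (proj₂ e)) added
  added-local = AllP.++⁺
    (path-endpoints v′ (p ∷ rest) v″ (inj₁ refl)
      (inj₂ (inj₂ (_ , refl)) ∷ AllP.map⁺ (AllP.tabulate⁺ (λ t → inj₂ (inj₂ (_ , refl)))))
      (inj₂ (inj₁ refl)))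
    (AllP.replicate⁺ m (inj₁ refl , inj₂ (inj₁ refl)))

  old-nonlocal : ∀ {x} → x ≢ v → ¬ Local (old x)
  old-nonlocal x≢v (inj₁ e)        = x≢v (old-injective e)
  old-nonlocal x≢v (inj₂ (inj₁ e)) = old≢new e
  old-nonlocal x≢v (inj₂ (inj₂ (_ , e))) = old≢new e

  inner≢split : ∀ {r z} → IsInner r → (z ≡ v′) ⊎ (z ≡ v″) → r ≢ z
  inner≢split (_ , refl) (inj₁ refl) = old≢new ∘ sym
  inner≢split (_ , refl) (inj₂ refl) = (λ ()) ∘ new-injective

  split≢old : ∀ {z x} → (z ≡ v′) ⊎ (z ≡ v″) → x ≢ v → z ≢ old x
  split≢old (inj₁ refl) x≢v = x≢v ∘ sym ∘ old-injective
  split≢old (inj₂ refl) x≢v = old≢new ∘ sym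

  side-split : ∀ b → (side b ≡ v′) ⊎ (side b ≡ v″)
  side-split true  = inj₂ refl
  side-split false = inj₁ refl

  ren-old : ∀ j {x} → x ≢ v → ren j x ≡ old x
  ren-old j {x} x≢v with x ≟ v
  ... | yes x≡v = ⊥-elim (x≢v x≡v)
  ... | no _    = refl

  ren-v : ∀ j → ren j v ≡ side (d j)
  ren-v j with v ≟ v
  ... | yes _   = refl
  ... | no v≢v  = ⊥-elim (v≢v refl)

  ren⁻¹-old : ∀ j {s x} → x ≢ v → ren j s ≡ old x → s ≡ x
  ren⁻¹-old j {s} x≢v e with s ≟ v
  ... | yes _ = ⊥-elim (split≢old (side-split (d j)) x≢v e)
  ... | no _  = old-injective e

  ren⁻¹-split : ∀ j {s z} → (z ≡ v′) ⊎ (z ≡ v″) → ren j s ≡ z → s ≡ v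
  ren⁻¹-split j {s} z-split e with s ≟ v
  ... | yes s≡v = s≡v
  ... | no s≢v  = ⊥-elim (split≢old z-split s≢v (sym e))

  ren-not-inner : ∀ j {s r} → IsInner r → ren j s ≢ r
  ren-not-inner j {s} (_ , refl) e with s ≟ v
  ... | yes _ = inner≢split (_ , refl) (side-split (d j)) (sym e)
  ... | no _  = old≢new e

  edge-cases : ∀ {z w} → Any (Joins z w) (edges G') →
    (∃[ j ] Joins z w (mapPair (ren j) (lookup (edges G) j))) ⊎ (Local z × Local w)
  edge-cases jn with AnyP.++⁻ old-images jn
  ... | inj₁ t = inj₁ (AnyP.tabulate⁻ t)
  ... | inj₂ t = inj₂ (All-Joins added-local t)

  image-edge : ∀ j {z w} → Joins z w (mapPair (ren j) (lookup (edges G) j)) → Any (Joins z w) (edges G')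
  image-edge j jn = AnyP.++⁺ˡ (AnyP.tabulate⁺ j jn)

  old-adj⇔ : ∀ {x y} → x ≢ v → y ≢ v → Adj G' (old x) (old y) ⇔ Adj G x y
  old-adj⇔ {x} {y} x≢v y≢v = mk⇔ to from
    where
    to : Adj G' (old x) (old y) → Adj G x y
    to (ne , jn) with edge-cases jn
    ... | inj₁ (j , J) = ne ∘ cong old , lose (∈-lookup j) (Joins-pull (ren⁻¹-old j x≢v) (ren⁻¹-old j y≢v) J)
    ... | inj₂ (lx , _) = ⊥-elim (old-nonlocal x≢v lx)
    from : Adj G x y → Adj G' (old x) (old y)
    from (ne , jn) = ne ∘ old-injective ,
      image-edge j (Joins-push {h = ren j} (ren-old j x≢v) (ren-old j y≢v) (AnyP.lookup-index jn))
      where j = Any.index jn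

  split-adj⇒ : ∀ {z x} → (z ≡ v′) ⊎ (z ≡ v″) → x ≢ v → Adj G' z (old x) → Adj G v x
  split-adj⇒ z-split x≢v (_ , jn) with edge-cases jn
  ... | inj₁ (j , J) = x≢v ∘ sym , lose (∈-lookup j) (Joins-pull (ren⁻¹-split j z-split) (ren⁻¹-old j x≢v) J)
  ... | inj₂ (_ , lx) = ⊥-elim (old-nonlocal x≢v lx)

  edge-at-v : ∀ j {x} → x ≢ v → Joins v x (lookup (edges G) j) → Adj G' (side (d j)) (old x)
  edge-at-v j x≢v J = split≢old (side-split (d j)) x≢v ,
    image-edge j (Joins-push (ren-v j) (ren-old j x≢v) J)

  split-cover : ∀ {x} → x ≢ v → Adj G v x → Adj G' v′ (old x) ⊎ Adj G' v″ (old x)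
  split-cover {x} x≢v (_ , jn) = by-side (d _) (edge-at-v (Any.index jn) x≢v (AnyP.lookup-index jn))
    where
    by-side : ∀ b → Adj G' (side b) (old x) → Adj G' v′ (old x) ⊎ Adj G' v″ (old x)
    by-side true  = inj₂
    by-side false = inj₁

  inner-¬adj : ∀ {r x} → IsInner r → x ≢ v → ¬ Adj G' r (old x)
  inner-¬adj r-inner x≢v (_ , jn) with edge-cases jn
  ... | inj₁ (j , J) with Joins-endpoint J
  ...   | inj₁ e = ren-not-inner j {proj₁ (lookup (edges G) j)} r-inner e
  ...   | inj₂ e = ren-not-inner j {proj₂ (lookup (edges G) j)} r-inner e
  inner-¬adj r-inner x≢v (_ , jn) | inj₂ (_ , lx) = old-nonlocal x≢v lx

  p-inner : IsInner p
  p-inner = _ , refl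

  q-inner : IsInner q
  q-inner = lastOf-All p-inner rest-inner

  p-adj : Adj G' p v′
  p-adj = inner≢split p-inner (inj₁ refl) ,
    AnyP.++⁺ʳ old-images (AnyP.++⁺ˡ {ys = replicate m (v′ , v″)} (here (inj₂ refl)))

  q-adj : Adj G' q v″
  q-adj = inner≢split q-inner (inj₂ refl) ,
    AnyP.++⁺ʳ old-images (AnyP.++⁺ˡ {ys = replicate m (v′ , v″)} (Any.map inj₁ (path-last-edge v′ (p ∷ rest) v″)))

  a : Fin 6
  a = φ v

  nbhd : Vertex → Subset 6
  nbhd z = Vec.tabulate λ w → not (does (w ≟ a)) ∧ does (Adj? G' z (old (g w)))

  nbhd⇔ : ∀ z w → T (nbhd z ⟨ w ⟩) ⇔ (w ≢ a × Adj G' z (old (g w)))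
  nbhd⇔ z w rewrite VecP.lookup∘tabulate (λ w → not (does (w ≟ a)) ∧ does (Adj? G' z (old (g w)))) w
    with w ≟ a
  ... | yes w≡a = mk⇔ (λ ()) (λ (w≢a , _) → w≢a w≡a)
  ... | no w≢a  = Eq.trans (does⇔ (Adj? G' z _)) (mk⇔ (w≢a ,_) proj₂)

  g≢v : ∀ {w} → w ≢ a → g w ≢ v
  g≢v w≢a = w≢a ∘ Equivalence.to g≡⇔

  module Side (z r : Vertex) (z-split : (z ≡ v′) ⊎ (z ≡ v″))
              (r-inner : IsInner r) (r-adj : Adj G' r z) where
    ι : Fin 6 → Vertex
    ι w = if does (w ≟ a) then z else old (g w)

    ι-injective : ∀ {x y} → ι x ≡ ι y → x ≡ y
    ι-injective {x} {y} e with x ≟ a | y ≟ a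
    ... | yes refl | yes refl = refl
    ... | yes _    | no y≢a   = ⊥-elim (split≢old z-split (g≢v y≢a) e)
    ... | no x≢a   | yes _    = ⊥-elim (split≢old z-split (g≢v x≢a) (sym e))
    ... | no _     | no _     = g-injective (old-injective e)

    ι-adj⇔ : ∀ x y → Adj G' (ι x) (ι y) ⇔ T (replaceNbhd a (nbhd z) x y)
    ι-adj⇔ x y with x ≟ a | y ≟ a
    ... | yes refl | yes refl = mk⇔ (λ z~z → ⊥-elim (proj₁ z~z refl))
                                    (λ t → ⊥-elim (proj₁ (Equivalence.to (nbhd⇔ z a) t) refl))
    ... | yes refl | no y≢a   = Eq.sym (Eq.trans (nbhd⇔ z y) (mk⇔ proj₂ (y≢a ,_)))
    ... | no x≢a   | yes refl = Eq.trans (Adj-sym⇔ G') (Eq.sym (Eq.trans (nbhd⇔ z x) (mk⇔ proj₂ (x≢a ,_))))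
    ... | no x≢a   | no y≢a   = Eq.trans (old-adj⇔ (g≢v x≢a) (g≢v y≢a)) (adj-frame x y)

    r-adj⇔ : ∀ w → Adj G' r (ι w) ⇔ (w ≡ a)
    r-adj⇔ w with w ≟ a
    ... | yes w≡a = mk⇔ (λ _ → w≡a) (λ _ → r-adj)
    ... | no w≢a  = mk⇔ (⊥-elim ∘ inner-¬adj r-inner (g≢v w≢a)) (⊥-elim ∘ w≢a)

    r-fresh : ∀ w → r ≢ ι w
    r-fresh w with w ≟ a
    ... | yes _ = inner≢split r-inner z-split
    ... | no _  = λ e → old≢new (trans (sym e) (proj₂ r-inner))

    realises : Realises (withPendant a (replaceNbhd a (nbhd z))) G'
    realises = pendant-realises ι r ι-injective r-fresh ι-adj⇔ r-adj⇔

  cover⇔ : ∀ w → ((w ≢ a × Adj G' v′ (old (g w))) ⊎ (w ≢ a × Adj G' v″ (old (g w)))) ⇔ Adj G (g a) (g w)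
  cover⇔ w = mk⇔ to from
    where
    to : (w ≢ a × Adj G' v′ (old (g w))) ⊎ (w ≢ a × Adj G' v″ (old (g w))) → Adj G (g a) (g w)
    to (inj₁ (w≢a , A)) = subst (λ c → Adj G c (g w)) (sym (g∘φ v)) (split-adj⇒ (inj₁ refl) (g≢v w≢a) A)
    to (inj₂ (w≢a , A)) = subst (λ c → Adj G c (g w)) (sym (g∘φ v)) (split-adj⇒ (inj₂ refl) (g≢v w≢a) A)
    from : Adj G (g a) (g w) → (w ≢ a × Adj G' v′ (old (g w))) ⊎ (w ≢ a × Adj G' v″ (old (g w)))
    from A = Sum.map (w≢a ,_) (w≢a ,_) (split-cover (g≢v w≢a) (subst (λ c → Adj G c (g w)) (g∘φ v) A))
      where
      w≢a : w ≢ a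
      w≢a w≡a = proj₁ A (sym (cong g w≡a))

  side-neighbour : ∀ b → (∃[ j ] IncidentAt G v j × d j ≡ b) → ∃[ w ] T (nbhd (side b) ⟨ w ⟩)
  side-neighbour b (j , inc , dj≡b) with incident-other G loopless j inc
  ... | x , x≢v , J = φ x , Equivalence.from (nbhd⇔ (side b) (φ x))
    ( x≢v ∘ Bijection.injective (proj₁ iso)
    , subst (λ y → Adj G' (side b) (old y)) (sym (g∘φ x))
        (subst (λ c → Adj G' (side c) (old x)) dj≡b (edge-at-v j x≢v J)) )

  splits : ValidDistribution G v d → Splits a (nbhd v′) (nbhd v″)
  splits (to-v′ , to-v″) = covers , side-neighbour false to-v′ , side-neighbour true to-v″
    where
    covers : ∀ w → (nbhd v′ ⟨ w ⟩ ∨ nbhd v″ ⟨ w ⟩) ≡ w5 a w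
    covers w = T-injective {nbhd v′ ⟨ w ⟩ ∨ nbhd v″ ⟨ w ⟩} {w5 a w}
      (Eq.trans (BoolP.T-∨ {nbhd v′ ⟨ w ⟩} {nbhd v″ ⟨ w ⟩}) (Eq.trans (nbhd⇔ v′ w ⊎-⇔ nbhd⇔ v″ w)
      (Eq.trans (cover⇔ w) (adj-frame a w))))

  claw : ValidDistribution G v d → HasClaw G'
  claw valid = Sum.[ claw-transfer (Side.realises v′ p (inj₁ refl) p-inner p-adj)
                   , claw-transfer (Side.realises v″ q (inj₂ refl) q-inner q-adj) ]′
    (replaceNbhd-claw a (nbhd v′) (nbhd v″) (splits valid))

lemma4p3 : (G : Graph) → Loopless G → UnderlyingIsW5 G →
    ((i : Fin (length (edges G))) (k : ℕ) → HasClaw (evenSubdivision G i k))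
    × ((v : Fin (n G)) (k m : ℕ) (d : Fin (length (edges G)) → Bool) →
         ValidDistribution G v d → HasClaw (oddExpansion G v k m d))
lemma4p3 G loopless iso =
  (λ i k → EvenSubdivision.claw G loopless iso i k) ,
  (λ v k m d → OddExpansion.claw G loopless iso v k m d)
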